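{- Let $k$ and $p$ be positive integers and let $\mathcal P=\{x_1+x_2=x_3+x_4,\ x_1+x_2=x_5+x_6,\ \dots,\ x_1+x_2=x_{2p-1}+x_{2p}\}$. Fix $i$ with $2p<i\le k$. Let $\mathcal S$ be a collection of difference equalities each containing $x_i$ such that $\mathcal S\cup\mathcal P$ is linearly independent and $c$-good, and $\mathcal S\cup\mathcal P$ does not imply $x_1+x_2=x_i+x_j$ for any $j>2p$. Then $\mathcal S\cup\mathcal P$ certifies at most $6|\mathcal S|$ pairs $(i,\bullet)$, i.e. there are at most $6|\mathcal S|$ indices $j<i$ such that $\mathcal S\cup\mathcal P$ certifies $(i,j)$.
   Context: Standing parameters: $\varepsilon,k_0,c$ satisfy $0<\varepsilon\le 1/4096$, $k_0\ge 32/\varepsilon^2$ and $2-\min\{\varepsilon^2/32,\,2/k_0\}\le c\le 2$. All linear equations are over $\mathbb Q$ in variables $x_1,\dots,x_k$, considered up to rearrangement but not scaling; the content of an equation is an expression $*$ with the equation reading $*=0$. Equations are independent if their contents are linearly independent; a collection implies an equation if its content is a $\mathbb Q$-linear combination of the contents of the collection. An equation contains a variable if its coefficient is nonzero. A difference equality is a nontrivial equation $x_{i_1}-x_{i_2}=x_{i_3}-x_{i_4}$ ($i_1,\dots,i_4\in[k]$ not necessarily distinct). A collection of difference equalities is valid if it does not imply $x_a=x_b$ for $a\ne b$; collinearity-free if it implies no equation containing exactly three variables; $c$-light if for every $t\ge1$ any $t$ independent equations it implies together contain at least $ct+1$ variables; $c$-good if valid, collinearity-free and $c$-light. For $a>b$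 in $[k]$, a collection certifies $(a,b)$ if it implies $x_a-x_b=x_{a'}-x_{b'}$ for some $(a',b')\in[k]^2$ with either $a',b'<a$, or $b'=a$ and $a'<b$.
   Formalization: The standing parameters ε, $k_0$ and c are taken over the rationals. -}

module Defs where

open import Data.Nat as ℕ using (ℕ; zero; suc)
open import Data.Fin using (Fin; zero; suc; toℕ; _<_)
open import Data.Fin.Properties using (all?)
open import Data.List using (List; []; _∷_; length; filter; map; applyUpTo; _++_)
open import Data.List.Relation.Unary.Any using (Any; any?)
open import Data.List.Relation.Unary.All using (All)
open import Data.List.Relation.Unary.Unique.Propositional using (Unique)
open import Data.Integer using (+_)
open import Data.Rational using (ℚ; 0ℚ; 1ℚ; _+_; _*_; _-_; _≤_; _/_)
open import Data.Rational.Properties using (_≟_)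
open import Data.Product using (Σ; _×_; ∃; ∃-syntax; _,_)
open import Data.Sum using (_⊎_)
open import Data.Bool using (if_then_else_)
open import Relation.Nullary using (¬_; ¬?)
open import Relation.Binary.PropositionalEquality using (_≡_; _≢_)

-- The content of a linear equation in x_1,…,x_k: a coefficient vector.
-- Position i : Fin k is the variable x_{toℕ i + 1} (1-based in the paper).
Content : ℕ → Set
Content k = Fin k → ℚ

ℕ→ℚ : ℕ → ℚ
ℕ→ℚ n = (+ n) / 1

zeroC : ∀ {k} → Content k
zeroC _ = 0ℚ

_⊕_ : ∀ {k} → Content k → Content k → Content k
(u ⊕ v) i = u i + v i

_⊖_ : ∀ {k} → Content k → Content k → Content k
(u ⊖ v) i = u i - v i

infixl 6 _⊕_ _⊖_

-- the variable x_n (1-based index n); zero if n ∉ [1,k]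
xN : ∀ {k} → ℕ → Content k
xN n i = if suc (toℕ i) ℕ.≡ᵇ n then 1ℚ else 0ℚ

xF : ∀ {k} → Fin k → Content k
xF a = xN (suc (toℕ a))

Contains : ∀ {k} → Content k → Fin k → Set
Contains e i = e i ≢ 0ℚ

numVars : ∀ {k} → List (Content k) → ℕ
numVars {k} es = length (filter (λ i → any? (λ e → ¬? (e i ≟ 0ℚ)) es) (Data.List.allFin k))
  where import Data.List

lincomb : ∀ {k} (L : List (Content k)) → (Fin (length L) → ℚ) → Content k
lincomb []      λs = zeroC
lincomb (v ∷ L) λs i = λs zero * v i + lincomb L (λ j → λs (suc j)) i

Implies : ∀ {k} → List (Content k) → Content k → Set
Implies L e = Σ (Fin (length L) → ℚ) λ λs → ∀ i → lincomb L λs i ≡ e i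

LinIndep : ∀ {k} → List (Content k) → Set
LinIndep L = ∀ λs → (∀ i → lincomb L λs i ≡ 0ℚ) → ∀ j → λs j ≡ 0ℚ

diffContent : ∀ {k} → Fin k → Fin k → Fin k → Fin k → Content k
diffContent i₁ i₂ i₃ i₄ = xF i₁ ⊖ xF i₂ ⊖ xF i₃ ⊕ xF i₄

IsDiffEq : ∀ {k} → Content k → Set
IsDiffEq {k} e = (∃[ i₁ ] ∃[ i₂ ] ∃[ i₃ ] ∃[ i₄ ] (∀ i → e i ≡ diffContent i₁ i₂ i₃ i₄ i))
                 × ¬ (∀ i → e i ≡ 0ℚ)

Valid : ∀ {k} → List (Content k) → Set
Valid L = ∀ a b → a ≢ b → ¬ Implies L (xF a ⊖ xF b)

CollinearityFree : ∀ {k} → List (Content k) → Set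
CollinearityFree L = ∀ e → Implies L e → numVars (e ∷ []) ≢ 3

Light : ∀ {k} → ℚ → List (Content k) → Set
Light c L = ∀ (es : List _) → 1 ℕ.≤ length es → All (Implies L) es → LinIndep es →
            c * ℕ→ℚ (length es) + 1ℚ ≤ ℕ→ℚ (numVars es)

Good : ∀ {k} → ℚ → List (Content k) → Set
Good c L = Valid L × CollinearityFree L × Light c L

-- L certifies (a,b) (intended for a > b)
Certifies : ∀ {k} → List (Content k) → Fin k → Fin k → Set
Certifies L a b = ∃[ a' ] ∃[ b' ]
  (((a' < a) × (b' < a)) ⊎ ((b' ≡ a) × (a' < b))) ×
  Implies L ((xF a ⊖ xF b) ⊖ (xF a' ⊖ xF b'))

-- 𝒫 = { x_1 + x_2 = x_{2l-1} + x_{2l} : 2 ≤ l ≤ p }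
𝒫 : (k p : ℕ) → List (Content k)
𝒫 k p = map (λ l → (xN 1 ⊕ xN 2) ⊖ (xN (2 ℕ.* l ℕ.∸ 1) ⊕ xN (2 ℕ.* l)))
            (applyUpTo (λ m → m ℕ.+ 2) (p ℕ.∸ 1))

Standing : ℚ → ℚ → ℚ → Set
Standing ε k₀ c =
  (0ℚ Data.Rational.< ε) × (ε ≤ (+ 1) / 4096) × (ℕ→ℚ 32 ≤ ε * ε * k₀) ×
  ((ℕ→ℚ 2 - c) ≤ ε * ε * ((+ 1) / 32)) × ((ℕ→ℚ 2 - c) * k₀ ≤ ℕ→ℚ 2) × (c ≤ ℕ→ℚ 2)

{-# OPTIONS --safe #-}
module Submission where

-- Every equation of S contains x_i and at most three further variables, so at most 3|S|
-- variables other than x_i occur in S.  Let (i, j) be certified, j < i, and suppose neither x_j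
-- nor its 𝒫-partner x_q (the other variable of the pair x_{2l−1}, x_{2l} containing x_j, if
-- any) occurs in S.  If x_j lies in no pair, every equation of S ∪ 𝒫 has coefficient 0 at x_j,
-- so the certificate x_i − x_j = x_a − x_b must have b = j, i.e. it is x_i = x_a, against
-- validity.  Otherwise every equation has equal coefficients at x_j and x_q, which forces the
-- certificate to be x_i − x_j = x_q − x_b; adding x_j + x_q = x_1 + x_2 gives
-- x_1 + x_2 = x_i + x_b, excluded for x_b outside the pairs and turned into x_i = x_{b′} by the
-- pair equation of x_b otherwise.  Hence every certified j lies in a set of at most 6|S|
-- indices: the variables of S and their partners.

open import Defs
open import Data.Nat using (ℕ; _≤_; _<_; _*_; suc)
open import Data.Fin using (Fin; toℕ)
open import Data.List using (List; length; _++_)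
open import Data.List.Relation.Unary.All using (All)
open import Data.List.Relation.Unary.Unique.Propositional using (Unique)
open import Data.Rational using (ℚ)
open import Data.Product using (_×_)
open import Relation.Nullary using (¬_)

open import Function using (_∘_)
open import Data.Bool using (Bool; if_then_else_)
open import Data.Empty using (⊥-elim)
open import Data.Sum using (_⊎_; inj₁; inj₂)
open import Data.Product using (Σ; ∃-syntax; _,_)
open import Data.Nat using (zero; z≤n; s≤s; s≤s⁻¹; _+_; _∸_; _≡ᵇ_; ⌊_/2⌋; ⌈_/2⌉; _≤?_)
import Data.Nat.Properties as ℕₚ
open import Data.Nat.Solver using (module +-*-Solver)
open import Data.Fin using (zero; suc; fromℕ<; _≟_)
open import Data.Fin.Properties using (toℕ-injective; toℕ-fromℕ<; toℕ<n; <⇒≢)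
open import Data.Rational using (0ℚ; 1ℚ; _-_) renaming (_+_ to _+ℚ_; _*_ to _*ℚ_)
import Data.Rational.Properties as ℚₚ
import Data.Rational.Solver as ℚSolver
open import Data.List using ([]; _∷_; map; filter)
open import Data.List.Properties using (length-map; length-++; filter-notAll)
open import Data.List.Membership.Propositional using (_∈_; _∉_)
open import Data.List.Membership.Propositional.Properties
  using (∈-map⁺; ∈-map⁻; ∈-++⁺ˡ; ∈-++⁺ʳ; ∈-filter⁺; ∈-applyUpTo⁺; ∈-applyUpTo⁻)
open import Data.List.Relation.Binary.Subset.Propositional using (_⊆_)
open import Data.List.Relation.Unary.Any as Any using (here; there; any?)
open import Data.List.Relation.Unary.All as All using ([]; _∷_)
open import Data.List.Relation.Unary.All.Properties using (++⁺)
open import Data.List.Relation.Unary.AllPairs using (_∷_)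
import Data.List.Relation.Unary.Unique.Propositional.Properties as Unique
open import Relation.Binary.Definitions using (DecidableEquality)
open import Relation.Binary.PropositionalEquality
open import Relation.Nullary using (yes; no; ¬?; contradiction)
open import Relation.Nullary.Decidable using (decidable-stable)

module _ {A : Set} (_≟ₐ_ : DecidableEquality A) where

  unique-⊆⇒length≤ : ∀ {xs ys : List A} → Unique xs → xs ⊆ ys → length xs ≤ length ys
  unique-⊆⇒length≤ {[]}     _                 _     = z≤n
  unique-⊆⇒length≤ {x ∷ xs} {ys} (x∉xs ∷ unique) xs⊆ys = begin-strict
    length xs                          ≤⟨ unique-⊆⇒length≤ unique xs⊆ys-x ⟩
    length (filter (¬? ∘ (x ≟ₐ_)) ys) <⟨ filter-notAll (¬? ∘ (x ≟ₐ_)) ys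
                                           (Any.map (λ x≡y x≢y → x≢y x≡y) (xs⊆ys (here refl))) ⟩
    length ys                          ∎
    where
    open ℕₚ.≤-Reasoning
    xs⊆ys-x : xs ⊆ filter (¬? ∘ (x ≟ₐ_)) ys
    xs⊆ys-x y∈xs = ∈-filter⁺ (¬? ∘ (x ≟ₐ_)) (xs⊆ys (there y∈xs)) (All.lookup x∉xs y∈xs)

-- Positions are 0-based (x_{t+1} sits at t); 𝒫 pairs the positions 2w and 2w + 1, and partner
-- swaps them.
partner : ℕ → ℕ
partner 0             = 1
partner 1             = 0
partner (suc (suc n)) = suc (suc (partner n))

partner-involutive : ∀ n → partner (partner n) ≡ n
partner-involutive 0             = refl
partner-involutive 1             = refl
partner-involutive (suc (suc n)) = cong (2 +_) (partner-involutive n)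

partner-≢ : ∀ n → partner n ≢ n
partner-≢ 0             ()
partner-≢ 1             ()
partner-≢ (suc (suc n)) eq = partner-≢ n (ℕₚ.suc-injective (ℕₚ.suc-injective eq))

⌊partner/2⌋ : ∀ n → ⌊ partner n /2⌋ ≡ ⌊ n /2⌋
⌊partner/2⌋ 0             = refl
⌊partner/2⌋ 1             = refl
⌊partner/2⌋ (suc (suc n)) = cong suc (⌊partner/2⌋ n)

partner-even : ∀ n → partner (n + n) ≡ suc (n + n)
partner-even zero    = refl
partner-even (suc n) rewrite ℕₚ.+-suc n n = cong (2 +_) (partner-even n)

m≤⌊n/2⌋⇒2*m≤n : ∀ {m n} → m ≤ ⌊ n /2⌋ → 2 * m ≤ n
m≤⌊n/2⌋⇒2*m≤n {m} {n} m≤⌊n/2⌋ = begin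
  2 * m             ≤⟨ ℕₚ.*-monoʳ-≤ 2 m≤⌊n/2⌋ ⟩
  2 * ⌊ n /2⌋       ≡⟨ cong (⌊ n /2⌋ +_) (ℕₚ.+-identityʳ ⌊ n /2⌋) ⟩
  ⌊ n /2⌋ + ⌊ n /2⌋ ≤⟨ ℕₚ.+-monoʳ-≤ ⌊ n /2⌋ (ℕₚ.⌊n/2⌋≤⌈n/2⌉ n) ⟩
  ⌊ n /2⌋ + ⌈ n /2⌉ ≡⟨ ℕₚ.⌊n/2⌋+⌈n/2⌉≡n n ⟩
  n                 ∎
  where open ℕₚ.≤-Reasoning

2*m≤n⇒m≤⌊n/2⌋ : ∀ {m n} → 2 * m ≤ n → m ≤ ⌊ n /2⌋
2*m≤n⇒m≤⌊n/2⌋ {m} {n} 2*m≤n = begin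
  m               ≡⟨ ℕₚ.n≡⌊n+n/2⌋ m ⟩
  ⌊ m + m /2⌋     ≡⟨ cong (λ x → ⌊ m + x /2⌋) (ℕₚ.+-identityʳ m) ⟨
  ⌊ 2 * m /2⌋     ≤⟨ ℕₚ.⌊n/2⌋-mono 2*m≤n ⟩
  ⌊ n /2⌋         ∎
  where open ℕₚ.≤-Reasoning

⌊m/2⌋<⌊n/2⌋⇒m<n : ∀ {m n} → ⌊ m /2⌋ < ⌊ n /2⌋ → m < n
⌊m/2⌋<⌊n/2⌋⇒m<n ⌊m/2⌋<⌊n/2⌋ = ℕₚ.≰⇒> (ℕₚ.<⇒≱ ⌊m/2⌋<⌊n/2⌋ ∘ ℕₚ.⌊n/2⌋-mono)

indicator : Bool → ℚ
indicator b = if b then 1ℚ else 0ℚ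

indicator-refl : ∀ n → indicator (n ≡ᵇ n) ≡ 1ℚ
indicator-refl zero    = refl
indicator-refl (suc n) = indicator-refl n

indicator-≢ : ∀ {m n} → m ≢ n → indicator (m ≡ᵇ n) ≡ 0ℚ
indicator-≢ {zero}  {zero}  0≢0 = contradiction refl 0≢0
indicator-≢ {zero}  {suc n} _   = refl
indicator-≢ {suc m} {zero}  _   = refl
indicator-≢ {suc m} {suc n} m≢n = indicator-≢ (m≢n ∘ cong suc)

indicator-partner : ∀ b t → indicator (t ≡ᵇ b) +ℚ indicator (t ≡ᵇ partner b) ≡
                            indicator (⌊ t /2⌋ ≡ᵇ ⌊ b /2⌋)
indicator-partner 0             0             = refl
indicator-partner 0             1             = refl
indicator-partner 0             (suc (suc t)) = refl
indicator-partner 1             0             = refl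
indicator-partner 1             1             = refl
indicator-partner 1             (suc (suc t)) = refl
indicator-partner (suc (suc b)) 0             = refl
indicator-partner (suc (suc b)) 1             = refl
indicator-partner (suc (suc b)) (suc (suc t)) = indicator-partner b t

-- x_i − x_j = x_a − x_b, bracketed as in Certifies (Defs.diffContent brackets it differently)
difference : ∀ {k} → Fin k → Fin k → Fin k → Fin k → Content k
difference i j a b = (xF i ⊖ xF j) ⊖ (xF a ⊖ xF b)

Absent : ∀ {k} → List (Content k) → Fin k → Set
Absent L v = All (λ e → e v ≡ 0ℚ) L

module _ {k : ℕ} where

  lincomb-zero : ∀ (L : List (Content k)) v → lincomb L (λ _ → 0ℚ) v ≡ 0ℚ
  lincomb-zero []      v = refl
  lincomb-zero (e ∷ L) v = cong₂ _+ℚ_ (ℚₚ.*-zeroˡ (e v)) (lincomb-zero L v)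

  lincomb-− : ∀ (L : List (Content k)) λs μs v →
              lincomb L (λ t → λs t - μs t) v ≡ lincomb L λs v - lincomb L μs v
  lincomb-− []      λs μs v = refl
  lincomb-− (e ∷ L) λs μs v = trans
    (cong ((λs zero - μs zero) *ℚ e v +ℚ_) (lincomb-− L (λs ∘ suc) (μs ∘ suc) v))
    (distribute (λs zero) (μs zero) (e v) _ _)
    where
    open ℚSolver.+-*-Solver
    distribute : ∀ a b x r s → (a - b) *ℚ x +ℚ (r - s) ≡ (a *ℚ x +ℚ r) - (b *ℚ x +ℚ s)
    distribute = solve 5 (λ a b x r s →
      (a :- b) :* x :+ (r :- s) := (a :* x :+ r) :- (b :* x :+ s)) refl

  lincomb-absent : ∀ {L : List (Content k)} {v} λs → Absent L v → lincomb L λs v ≡ 0ℚ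
  lincomb-absent λs []            = refl
  lincomb-absent λs (ev≡0 ∷ rest) = cong₂ _+ℚ_
    (trans (cong (λs zero *ℚ_) ev≡0) (ℚₚ.*-zeroʳ (λs zero)))
    (lincomb-absent (λs ∘ suc) rest)

  lincomb-agree : ∀ {L : List (Content k)} {j q} λs → All (λ e → e j ≡ e q) L →
                  lincomb L λs j ≡ lincomb L λs q
  lincomb-agree λs []             = refl
  lincomb-agree λs (ej≡eq ∷ rest) =
    cong₂ _+ℚ_ (cong (λs zero *ℚ_) ej≡eq) (lincomb-agree (λs ∘ suc) rest)

  -- L is a module parameter because it cannot be inferred from Implies L e.
  module Implication (L : List (Content k)) where

    implies-resp-≗ : ∀ {e e′} → e ≗ e′ → Implies L e → Implies L e′
    implies-resp-≗ e≗e′ (λs , sum≗e) = λs , λ v → trans (sum≗e v) (e≗e′ v)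

    implies-zeroC : Implies L zeroC
    implies-zeroC = (λ _ → 0ℚ) , lincomb-zero L

    implies-⊖ : ∀ {e e′} → Implies L e → Implies L e′ → Implies L (e ⊖ e′)
    implies-⊖ (λs , sum≗e) (μs , sum≗e′) =
      (λ t → λs t - μs t) , λ v → trans (lincomb-− L λs μs v) (cong₂ _-_ (sum≗e v) (sum≗e′ v))

  implied-absent : ∀ {L : List (Content k)} {e v} → Absent L v → Implies L e → e v ≡ 0ℚ
  implied-absent {v = v} absent (λs , sum≗e) = trans (sym (sum≗e v)) (lincomb-absent λs absent)

  implied-agree : ∀ {L : List (Content k)} {e j q} → All (λ e′ → e′ j ≡ e′ q) L → Implies L e →
                  e j ≡ e q
  implied-agree {j = j} {q} agree (λs , sum≗e) =
    trans (sym (sum≗e j)) (trans (lincomb-agree λs agree) (sum≗e q))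

  implies-∈ : ∀ {L : List (Content k)} {e} → e ∈ L → Implies L e
  implies-∈ {e ∷ L} (here refl) = (λ { zero → 1ℚ ; (suc _) → 0ℚ }) , λ v →
    trans (cong₂ _+ℚ_ (ℚₚ.*-identityˡ (e v)) (lincomb-zero L v)) (ℚₚ.+-identityʳ (e v))
  implies-∈ {e′ ∷ L} (there e∈L) with μs , sum≗e ← implies-∈ e∈L =
    (λ { zero → 0ℚ ; (suc t) → μs t }) , λ v →
    trans (cong₂ _+ℚ_ (ℚₚ.*-zeroˡ (e′ v)) (sum≗e v)) (ℚₚ.+-identityˡ _)

module _ {k : ℕ} where

  xF-self : (a : Fin k) → xF a a ≡ 1ℚ
  xF-self a = indicator-refl (toℕ a)

  xF-other : ∀ {a v : Fin k} → a ≢ v → xF a v ≡ 0ℚ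
  xF-other a≢v = indicator-≢ (a≢v ∘ sym ∘ toℕ-injective)

  xF-bit : (a v : Fin k) → xF a v ≡ 0ℚ ⊎ xF a v ≡ 1ℚ
  xF-bit a v with a ≟ v
  ... | yes refl = inj₂ (xF-self a)
  ... | no  a≢v  = inj₁ (xF-other a≢v)

  diffContent-outside : ∀ {i₁ i₂ i₃ i₄ v : Fin k} → v ∉ i₁ ∷ i₂ ∷ i₃ ∷ i₄ ∷ [] →
                        diffContent i₁ i₂ i₃ i₄ v ≡ 0ℚ
  diffContent-outside v∉ = cong₂ _+ℚ_
    (cong₂ _-_ (cong₂ _-_ (xF-other (v∉ ∘ here ∘ sym)) (xF-other (v∉ ∘ there ∘ here ∘ sym)))
               (xF-other (v∉ ∘ there ∘ there ∘ here ∘ sym)))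
    (xF-other (v∉ ∘ there ∘ there ∘ there ∘ here ∘ sym))

  difference-at : ∀ (i j a b v : Fin k) {α β γ δ} →
                  xF i v ≡ α → xF j v ≡ β → xF a v ≡ γ → xF b v ≡ δ →
                  difference i j a b v ≡ (α - β) - (γ - δ)
  difference-at _ _ _ _ _ i≡ j≡ a≡ b≡ = cong₂ _-_ (cong₂ _-_ i≡ j≡) (cong₂ _-_ a≡ b≡)

  -- For b ≢ j the coefficient of x_j in difference i j a b is −1 − [a = j], which is negative.
  coefficient-negative : ∀ {α δ} → α ≡ 0ℚ ⊎ α ≡ 1ℚ → δ ≡ 0ℚ ⊎ δ ≡ 1ℚ →
                         (0ℚ - 1ℚ) - (α - 0ℚ) ≢ (0ℚ - 0ℚ) - (0ℚ - δ)
  coefficient-negative (inj₁ refl) (inj₁ refl) = λ ()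
  coefficient-negative (inj₁ refl) (inj₂ refl) = λ ()
  coefficient-negative (inj₂ refl) (inj₁ refl) = λ ()
  coefficient-negative (inj₂ refl) (inj₂ refl) = λ ()

  difference-vanishing : ∀ {i j a b : Fin k} → i ≢ j → difference i j a b j ≡ 0ℚ → b ≡ j
  difference-vanishing {i} {j} {a} {b} i≢j vanishes with b ≟ j
  ... | yes b≡j = b≡j
  ... | no  b≢j = contradiction
    (trans (sym (difference-at i j a b j (xF-other i≢j) (xF-self j) refl (xF-other b≢j))) vanishes)
    (coefficient-negative (xF-bit a j) (inj₁ refl))

  difference-balanced : ∀ {i j q a b : Fin k} → i ≢ j → i ≢ q → j ≢ q →
                        difference i j a b j ≡ difference i j a b q → b ≡ j ⊎ a ≡ q
  difference-balanced {i} {j} {q} {a} {b} i≢j i≢q j≢q balanced with b ≟ j | a ≟ q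
  ... | yes b≡j | _        = inj₁ b≡j
  ... | no  _   | yes a≡q  = inj₂ a≡q
  ... | no  b≢j | no  a≢q  = contradiction
    (trans (sym (difference-at i j a b j (xF-other i≢j) (xF-self j) refl (xF-other b≢j)))
           (trans balanced
                  (difference-at i j a b q (xF-other i≢q) (xF-other j≢q) (xF-other a≢q) refl)))
    (coefficient-negative (xF-bit a j) (xF-bit b q))

  module _ {L : List (Content k)} (valid : Valid L) {i j : Fin k} (j<i : toℕ j < toℕ i) where
    open Implication L

    ¬degenerate-certificate : ∀ {a b} →
      ((toℕ a < toℕ i) × (toℕ b < toℕ i)) ⊎ ((b ≡ i) × (toℕ a < toℕ j)) →
      b ≡ j → ¬ Implies L (difference i j a b)
    ¬degenerate-certificate {a} (inj₁ (a<i , _)) refl implied =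
      valid i a (≢-sym (<⇒≢ a<i)) (implies-resp-≗ (λ v → cancel (xF i v) (xF j v) (xF a v)) implied)
      where
      open ℚSolver.+-*-Solver
      cancel : ∀ x y z → (x - y) - (z - y) ≡ x - z
      cancel = solve 3 (λ x y z → (x :- y) :- (z :- y) := x :- z) refl
    ¬degenerate-certificate (inj₂ (b≡i , _)) b≡j _ = <⇒≢ j<i (trans (sym b≡j) b≡i)

    ¬certifies-absent : Absent L j → ¬ Certifies L i j
    ¬certifies-absent absent (a , b , shape , implied) = ¬degenerate-certificate shape
      (difference-vanishing (≢-sym (<⇒≢ j<i)) (implied-absent absent implied)) implied

    certifies-agreeing : ∀ {q} → q ≢ i → j ≢ q → All (λ e → e j ≡ e q) L → Certifies L i j →
                         ∃[ b ] Implies L (difference i j q b)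
    certifies-agreeing q≢i j≢q agree (a , b , shape , implied)
      with difference-balanced (≢-sym (<⇒≢ j<i)) (≢-sym q≢i) j≢q (implied-agree agree implied)
    ... | inj₁ b≡j = ⊥-elim (¬degenerate-certificate shape b≡j implied)
    ... | inj₂ refl = b , implied

module _ {k : ℕ} where

  -- block w is x_{2w+1} + x_{2w+2}; 𝒫 consists of the equations block 0 = block w for 0 < w < p.
  block : ℕ → Content k
  block w v = indicator (⌊ toℕ v /2⌋ ≡ᵇ w)

  xF⊕xF-partner : ∀ {b r : Fin k} → toℕ r ≡ partner (toℕ b) → xF b ⊕ xF r ≗ block ⌊ toℕ b /2⌋
  xF⊕xF-partner {b} r≡ v = trans
    (cong (λ n → xF b v +ℚ indicator (toℕ v ≡ᵇ n)) r≡)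
    (indicator-partner (toℕ b) (toℕ v))

  xN⊕xN-pair : ∀ n → xN (suc (n + n)) ⊕ xN (suc (suc (n + n))) ≗ block n
  xN⊕xN-pair n v = begin
    indicator (toℕ v ≡ᵇ n + n) +ℚ indicator (toℕ v ≡ᵇ suc (n + n))
      ≡⟨ cong (λ m → indicator (toℕ v ≡ᵇ n + n) +ℚ indicator (toℕ v ≡ᵇ m)) (partner-even n) ⟨
    indicator (toℕ v ≡ᵇ n + n) +ℚ indicator (toℕ v ≡ᵇ partner (n + n))
      ≡⟨ indicator-partner (n + n) (toℕ v) ⟩
    indicator (⌊ toℕ v /2⌋ ≡ᵇ ⌊ n + n /2⌋)
      ≡⟨ cong (λ m → indicator (⌊ toℕ v /2⌋ ≡ᵇ m)) (ℕₚ.n≡⌊n+n/2⌋ n) ⟨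
    block n v ∎
    where open ≡-Reasoning

  pairEquation : ℕ → Content k
  pairEquation l = (xN 1 ⊕ xN 2) ⊖ (xN (2 * l ∸ 1) ⊕ xN (2 * l))

  pairEquation-block : ∀ m → pairEquation (m + 2) ≗ block 0 ⊖ block (suc m)
  pairEquation-block m v = trans
    (cong (λ l → (xN 1 ⊕ xN 2) v - (xN (l ∸ 1) ⊕ xN l) v) (double m))
    (cong₂ _-_ (xN⊕xN-pair 0 v) (xN⊕xN-pair (suc m) v))
    where
    open +-*-Solver
    double : ∀ m → 2 * (m + 2) ≡ 2 + (suc m + suc m)
    double = solve 1 (λ m → con 2 :* (m :+ con 2) := con 2 :+ ((con 1 :+ m) :+ (con 1 :+ m))) refl

  module _ {p : ℕ} where

    𝒫-equation : ∀ {e} → e ∈ 𝒫 k p → ∃[ w ] w < p × e ≗ block 0 ⊖ block w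
    𝒫-equation e∈𝒫 with ∈-map⁻ pairEquation e∈𝒫
    ... | l , l∈ , refl with ∈-applyUpTo⁻ (_+ 2) l∈
    ...   | m , m<p∸1 , refl = suc m , m<n∸1⇒1+m<n m<p∸1 , pairEquation-block m
      where
      m<n∸1⇒1+m<n : ∀ {m n} → m < n ∸ 1 → suc m < n
      m<n∸1⇒1+m<n {n = suc _} m<n∸1 = s≤s m<n∸1

    𝒫-absent : ∀ {v} → p ≤ ⌊ toℕ v /2⌋ → Absent (𝒫 k p) v
    𝒫-absent {v} p≤⌊v/2⌋ = All.tabulate λ e∈𝒫 →
      let w , w<p , e≗ = 𝒫-equation e∈𝒫
          w<⌊v/2⌋      = ℕₚ.<-≤-trans w<p p≤⌊v/2⌋
      in  trans (e≗ v) (cong₂ _-_ (indicator-≢ (≢-sym (ℕₚ.<⇒≢ (ℕₚ.≤-<-trans z≤n w<⌊v/2⌋))))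
                                  (indicator-≢ (≢-sym (ℕₚ.<⇒≢ w<⌊v/2⌋))))

    𝒫-agree : ∀ {v v′} → ⌊ toℕ v /2⌋ ≡ ⌊ toℕ v′ /2⌋ → All (λ e → e v ≡ e v′) (𝒫 k p)
    𝒫-agree {v} {v′} same-pair = All.tabulate λ e∈𝒫 →
      let w , _ , e≗ = 𝒫-equation e∈𝒫
      in  trans (e≗ v) (trans (cong (λ n → indicator (n ≡ᵇ 0) - indicator (n ≡ᵇ w)) same-pair)
                              (sym (e≗ v′)))

    module _ {L : List (Content k)} (𝒫⊆L : 𝒫 k p ⊆ L) where
      open Implication L

      𝒫-implies-block : ∀ {w} → w < p → Implies L (block 0 ⊖ block w)
      𝒫-implies-block {zero}  _   =
        implies-resp-≗ (λ v → sym (ℚₚ.+-inverseʳ (block 0 v))) implies-zeroC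
      𝒫-implies-block {suc m} w<p = implies-resp-≗ (pairEquation-block m)
        (implies-∈ (𝒫⊆L (∈-map⁺ pairEquation (∈-applyUpTo⁺ (_+ 2) (ℕₚ.∸-monoˡ-< w<p (s≤s z≤n))))))

      pair-implied : ∀ {b r : Fin k} → ⌊ toℕ b /2⌋ < p → toℕ r ≡ partner (toℕ b) →
                     Implies L ((xN 1 ⊕ xN 2) ⊖ (xF b ⊕ xF r))
      pair-implied b-paired r≡ = implies-resp-≗
        (λ v → sym (cong₂ _-_ (xN⊕xN-pair 0 v) (xF⊕xF-partner r≡ v)))
        (𝒫-implies-block b-paired)

  partner-below : (i : Fin k) {n : ℕ} → ⌊ n /2⌋ < ⌊ toℕ i /2⌋ →
                  Σ (Fin k) λ q → toℕ q ≡ partner n × toℕ q < toℕ i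
  partner-below i {n} ⌊n/2⌋<⌊i/2⌋ =
    fromℕ< (ℕₚ.<-trans partner<i (toℕ<n i)) , toℕ-fromℕ< _ ,
    subst (_< toℕ i) (sym (toℕ-fromℕ< _)) partner<i
    where
    partner<i : partner n < toℕ i
    partner<i = ⌊m/2⌋<⌊n/2⌋⇒m<n (subst (_< ⌊ toℕ i /2⌋) (sym (⌊partner/2⌋ n)) ⌊n/2⌋<⌊i/2⌋)


module _ {k : ℕ} (i : Fin k) where

    diffEq-support : ∀ {e} → IsDiffEq e → Contains e i →
                       ∃[ W ] length W ≤ 3 × (∀ v → v ≢ i → toℕ v ∉ W → e v ≡ 0ℚ)
    diffEq-support {e} ((i₁ , i₂ , i₃ , i₄ , e≗) , _) e∋i =
      map toℕ others , |others|≤3 , vanishes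
      where
      I others : List (Fin k)
      I      = i₁ ∷ i₂ ∷ i₃ ∷ i₄ ∷ []
      others = filter (¬? ∘ (_≟ i)) I

      outside : ∀ {v} → v ∉ I → e v ≡ 0ℚ
      outside v∉I = trans (e≗ _) (diffContent-outside v∉I)

      |others|≤3 : length (map toℕ others) ≤ 3
      |others|≤3 = subst (_≤ 3) (sym (length-map toℕ others)) (s≤s⁻¹ (filter-notAll (¬? ∘ (_≟ i)) I
        (Any.map (λ i≡v v≢i → v≢i (sym i≡v)) (decidable-stable (any? (i ≟_) I) (e∋i ∘ outside)))))

      vanishes : ∀ v → v ≢ i → toℕ v ∉ map toℕ others → e v ≡ 0ℚ
      vanishes v v≢i v∉others =
        outside (λ v∈I → v∉others (∈-map⁺ toℕ (∈-filter⁺ (¬? ∘ (_≟ i)) v∈I v≢i)))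

    diffEqs-support : ∀ {S : List (Content k)} → All (λ e → IsDiffEq e × Contains e i) S →
                     ∃[ W ] length W ≤ 3 * length S × (∀ v → v ≢ i → toℕ v ∉ W → Absent S v)
    diffEqs-support [] = [] , z≤n , λ _ _ _ → []
    diffEqs-support {_ ∷ S} ((diffEq , e∋i) ∷ rest)
      with W₁ , |W₁|≤3 , W₁-covers ← diffEq-support diffEq e∋i
         | W₂ , |W₂|≤3|S| , W₂-covers ← diffEqs-support rest =
      W₁ ++ W₂ , |W₁++W₂|≤ ,
      λ v v≢i v∉W → W₁-covers v v≢i (v∉W ∘ ∈-++⁺ˡ) ∷ W₂-covers v v≢i (v∉W ∘ ∈-++⁺ʳ W₁)
      where
      |W₁++W₂|≤ : length (W₁ ++ W₂) ≤ 3 * suc (length S)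
      |W₁++W₂|≤ = begin
        length (W₁ ++ W₂)      ≡⟨ length-++ W₁ ⟩
        length W₁ + length W₂  ≤⟨ ℕₚ.+-mono-≤ |W₁|≤3 |W₂|≤3|S| ⟩
        3 + 3 * length S       ≡⟨ ℕₚ.*-suc 3 (length S) ⟨
        3 * suc (length S)     ∎
        where open ℕₚ.≤-Reasoning

module _ {k p : ℕ} {S : List (Content k)} {i : Fin k} (pairs≤i : p ≤ ⌊ toℕ i /2⌋)
         (valid : Valid (S ++ 𝒫 k p))
         (no-unpaired-sum : ∀ (b : Fin k) → 2 * p < suc (toℕ b) →
                            ¬ Implies (S ++ 𝒫 k p) ((xN 1 ⊕ xN 2) ⊖ (xF i ⊕ xF b)))
  where
  open Implication (S ++ 𝒫 k p)

  -- For b inside a pair, x_1 + x_2 = x_b + x_b′ turns x_1 + x_2 = x_i + x_b into x_i = x_b′.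
  ¬implies-sum : ∀ b → ¬ Implies (S ++ 𝒫 k p) ((xN 1 ⊕ xN 2) ⊖ (xF i ⊕ xF b))
  ¬implies-sum b implied with p ≤? ⌊ toℕ b /2⌋
  ... | yes p≤⌊b/2⌋ = no-unpaired-sum b (s≤s (m≤⌊n/2⌋⇒2*m≤n p≤⌊b/2⌋)) implied
  ... | no  p≰⌊b/2⌋
    with r , r≡ , r<i ← partner-below i (ℕₚ.<-≤-trans (ℕₚ.≰⇒> p≰⌊b/2⌋) pairs≤i) =
    valid r i (<⇒≢ r<i)
      (implies-resp-≗ (λ v → cancel ((xN 1 ⊕ xN 2) v) (xF i v) (xF b v) (xF r v))
        (implies-⊖ implied (pair-implied (∈-++⁺ʳ S) (ℕₚ.≰⇒> p≰⌊b/2⌋) r≡)))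
    where
    open ℚSolver.+-*-Solver
    cancel : ∀ n x y z → (n - (x +ℚ y)) - (n - (y +ℚ z)) ≡ z - x
    cancel = solve 4 (λ n x y z → (n :- (x :+ y)) :- (n :- (y :+ z)) := z :- x) refl

  ¬certifies-paired : ∀ {j q} → toℕ j < toℕ i → ⌊ toℕ j /2⌋ < p → toℕ q ≡ partner (toℕ j) →
                      toℕ q < toℕ i → Absent S j → Absent S q → ¬ Certifies (S ++ 𝒫 k p) i j
  ¬certifies-paired {j} {q} j<i j-paired q≡ q<i j-absent q-absent certified =
    let b , implied = certifies-agreeing valid j<i (<⇒≢ q<i) j≢q agree certified
    in  ¬implies-sum b
          (implies-resp-≗ (λ v → through-pair ((xN 1 ⊕ xN 2) v) (xF i v) (xF j v) (xF q v) (xF b v))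
            (implies-⊖ (pair-implied (∈-++⁺ʳ S) j-paired q≡) implied))
    where
    j≢q : j ≢ q
    j≢q j≡q = partner-≢ (toℕ j) (trans (sym q≡) (cong toℕ (sym j≡q)))

    agree : All (λ e → e j ≡ e q) (S ++ 𝒫 k p)
    agree = ++⁺ (All.zipWith (λ (ej≡0 , eq≡0) → trans ej≡0 (sym eq≡0)) (j-absent , q-absent))
                (𝒫-agree {p = p} (trans (sym (⌊partner/2⌋ (toℕ j))) (cong ⌊_/2⌋ (sym q≡))))

    open ℚSolver.+-*-Solver
    through-pair : ∀ n x y z w → (n - (y +ℚ z)) - ((x - y) - (z - w)) ≡ n - (x +ℚ w)
    through-pair = solve 5 (λ n x y z w →
      (n :- (y :+ z)) :- ((x :- y) :- (z :- w)) := n :- (x :+ w)) refl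

  module _ (W : List ℕ) (W-covers : ∀ v → v ≢ i → toℕ v ∉ W → Absent S v) where

    outside-W-absent : ∀ {v} → toℕ v < toℕ i → toℕ v ∉ W → Absent S v
    outside-W-absent {v} v<i = W-covers v (<⇒≢ v<i)

    certified-touches-W : ∀ {j} → toℕ j < toℕ i × Certifies (S ++ 𝒫 k p) i j →
                          toℕ j ∈ W ++ map partner W
    certified-touches-W {j} (j<i , certified)
      with any? (toℕ j ℕₚ.≟_) W | any? (partner (toℕ j) ℕₚ.≟_) W
    ... | yes j∈W | _        = ∈-++⁺ˡ j∈W
    ... | no  _   | yes j′∈W =
      ∈-++⁺ʳ W (subst (_∈ map partner W) (partner-involutive (toℕ j)) (∈-map⁺ partner j′∈W))
    ... | no  j∉W | no  j′∉W with p ≤? ⌊ toℕ j /2⌋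
    ...   | yes p≤⌊j/2⌋ = ⊥-elim (¬certifies-absent valid j<i
              (++⁺ (outside-W-absent j<i j∉W) (𝒫-absent p≤⌊j/2⌋)) certified)
    ...   | no  p≰⌊j/2⌋
      with q , q≡ , q<i ← partner-below i (ℕₚ.<-≤-trans (ℕₚ.≰⇒> p≰⌊j/2⌋) pairs≤i) =
      ⊥-elim (¬certifies-paired j<i (ℕₚ.≰⇒> p≰⌊j/2⌋) q≡ q<i (outside-W-absent j<i j∉W)
                (outside-W-absent q<i (subst (_∉ W) (sym q≡) j′∉W)) certified)

    certified-length≤ : ∀ {js} → Unique js →
                        All (λ j → toℕ j < toℕ i × Certifies (S ++ 𝒫 k p) i j) js →
                        length js ≤ 2 * length W
    certified-length≤ {js} unique certified = begin
      length js                          ≡⟨ length-map toℕ js ⟨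
      length (map toℕ js)                ≤⟨ unique-⊆⇒length≤ ℕₚ._≟_ unique-toℕs js⊆ ⟩
      length (W ++ map partner W)        ≡⟨ length-++ W ⟩
      length W + length (map partner W)  ≡⟨ cong (length W +_) (length-map partner W) ⟩
      length W + length W                ≡⟨ cong (length W +_) (ℕₚ.+-identityʳ (length W)) ⟨
      2 * length W                       ∎
      where
      open ℕₚ.≤-Reasoning
      unique-toℕs : Unique (map toℕ js)
      unique-toℕs = Unique.map⁺ toℕ-injective unique
      js⊆ : map toℕ js ⊆ W ++ map partner W
      js⊆ n∈ with j , j∈js , refl ← ∈-map⁻ toℕ n∈ = certified-touches-W (All.lookup certified j∈js)

lemma4p4 : (ε k₀ c : ℚ) → Standing ε k₀ c →
    (k p : ℕ) → 1 ≤ k → 1 ≤ p →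
    (i : Fin k) → 2 * p < suc (toℕ i) →
    (S : List (Content k)) →
    All (λ e → IsDiffEq e × Contains e i) S →
    LinIndep (S ++ 𝒫 k p) →
    Good c (S ++ 𝒫 k p) →
    (∀ (j : Fin k) → 2 * p < suc (toℕ j) →
      ¬ Implies (S ++ 𝒫 k p) ((xN 1 ⊕ xN 2) ⊖ (xF i ⊕ xF j))) →
    (js : List (Fin k)) → Unique js →
    All (λ j → (toℕ j < toℕ i) × Certifies (S ++ 𝒫 k p) i j) js →
    length js ≤ 6 * length S
lemma4p4 _ _ _ _ k p _ _ i 2p<i S S-eqs _ (valid , _) no-unpaired-sum js unique certified =
  let W , |W|≤3|S| , W-covers = diffEqs-support i S-eqs in begin
    length js           ≤⟨ certified-length≤ pairs≤i valid no-unpaired-sum W W-covers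
                                               unique certified ⟩
    2 * length W        ≤⟨ ℕₚ.*-monoʳ-≤ 2 |W|≤3|S| ⟩
    2 * (3 * length S)  ≡⟨ ℕₚ.*-assoc 2 3 (length S) ⟨
    6 * length S        ∎
  where
  open ℕₚ.≤-Reasoning
  pairs≤i : p ≤ ⌊ toℕ i /2⌋
  pairs≤i = 2*m≤n⇒m≤⌊n/2⌋ (s≤s⁻¹ 2p<i)
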